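{- Let $X$ be a finite set with $|X|\ge 2$, let $\mathcal{H}$ be a hierarchy on $X$ and $\mathcal{P}$ a partition of $X$. Then $\mathcal{H}$ and $\mathcal{P}$ are r-compatible if and only if no set $Y\in\mathcal{H}$ overlaps with two distinct sets $A,B\in\mathcal{P}$.
   Context: Two sets $A,B$ overlap if $A\cap B$, $A\setminus B$, $B\setminus A$ are all nonempty. A rooted phylogenetic tree $T$ on $X$ is a rooted tree whose leaf set is $X$ and in which every non-leaf vertex has at least two children; $T(u)$ is the subtree rooted at $u$. A hierarchy on $X$ is a set system $\mathcal{H}\subseteq 2^X$ with $\emptyset\notin\mathcal{H}$, $X\in\mathcal{H}$, all singletons in $\mathcal{H}$, and no two members overlapping. Hierarchies correspond bijectively to rooted phylogenetic trees via $\mathcal{H}(T)=\{L(T(v)):v\in V(T)\}$. For $H\subseteq E(T)$, $\mathcal{F}(T,H)$ is the partition of $X$ into leaf sets of the connected components of $T-H$. A partition $\mathcal{P}$ and a hierarchy $\mathcal{H}$ (with tree $T$) are compatible if $\mathcal{P}=\mathcal{F}(T,H)$ for some $H\subseteq E(T)$. A hierarchy $\mathcal{H}^*$ on $X$ is a refinement of $\mathcal{H}$ if $\mathcal{H}\subseteq\mathcal{H}^*$. $\mathcal{H}$ and $\mathcal{P}$ are r-compatible if some refinement of $\mathcal{H}$ is compatible with $\mathcal{P}$. -}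

module Defs where

open import Data.Nat using (ℕ)
open import Data.Bool using (Bool; true; false)
open import Data.Fin using (Fin)
open import Data.Fin.Subset using (Subset; _∈_; _∉_; _⊆_; _⊂_; ⁅_⁆; Nonempty)
  renaming (⊥ to ∅; ⊤ to Full)
open import Data.Product using (Σ; ∃; _×_; _,_)
open import Data.Empty using (⊥)
open import Relation.Nullary using (¬_)
open import Relation.Binary.PropositionalEquality using (_≡_; _≢_)
open import Relation.Binary.Construct.Closure.Equivalence using (EqClosure)
open import Function.Bundles using (_⇔_)

-- The ground set X is Fin n; subsets of X are Data.Fin.Subset.
-- A set system on X is a (decidable) predicate on subsets of X.
SetSystem : ℕ → Set
SetSystem n = Subset n → Bool

infix 4 _∈ₛ_
_∈ₛ_ : ∀ {n} → Subset n → SetSystem n → Set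
A ∈ₛ 𝓢 = 𝓢 A ≡ true

Overlap : ∀ {n} → Subset n → Subset n → Set
Overlap A B =
  (∃ λ x → x ∈ A × x ∈ B) × (∃ λ x → x ∈ A × x ∉ B) × (∃ λ x → x ∈ B × x ∉ A)

record IsHierarchy {n : ℕ} (𝓗 : SetSystem n) : Set where
  field
    empty∉     : ¬ (∅ ∈ₛ 𝓗)
    full∈      : Full ∈ₛ 𝓗
    singleton∈ : ∀ x → ⁅ x ⁆ ∈ₛ 𝓗
    noOverlap  : ∀ A B → A ∈ₛ 𝓗 → B ∈ₛ 𝓗 → ¬ Overlap A B

record IsPartition {n : ℕ} (𝓟 : SetSystem n) : Set where
  field
    nonempty : ∀ A → A ∈ₛ 𝓟 → Nonempty A
    disjoint : ∀ A B → A ∈ₛ 𝓟 → B ∈ₛ 𝓟 → A ≢ B → ∀ x → x ∈ A → x ∉ B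
    cover    : ∀ x → ∃ λ A → A ∈ₛ 𝓟 × x ∈ A

IsRefinement : ∀ {n} → SetSystem n → SetSystem n → Set
IsRefinement 𝓗 𝓗* = IsHierarchy 𝓗* × (∀ A → A ∈ₛ 𝓗 → A ∈ₛ 𝓗*)

-- The rooted phylogenetic tree T(𝓗) of a hierarchy 𝓗: its vertices are the
-- clusters of 𝓗 (vertex v ↦ L(T(v))), the leaf x is the vertex ⁅ x ⁆, and
-- there is an edge (C , D) from a child C to its parent D iff C ⊂ D in 𝓗
-- with no cluster of 𝓗 strictly in between.
TreeEdge : ∀ {n} → SetSystem n → Subset n → Subset n → Set
TreeEdge 𝓗 C D =
  C ∈ₛ 𝓗 × D ∈ₛ 𝓗 × C ⊂ D × (∀ E → E ∈ₛ 𝓗 → C ⊂ E → E ⊂ D → ⊥)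

-- A set of edges H ⊆ E(T(𝓗)), given as a Boolean predicate on ordered pairs.
EdgeSubset : ∀ {n} → SetSystem n → (Subset n → Subset n → Bool) → Set
EdgeSubset 𝓗 Cut = ∀ C D → Cut C D ≡ true → TreeEdge 𝓗 C D

ForestAdj : ∀ {n} → SetSystem n → (Subset n → Subset n → Bool)
          → Subset n → Subset n → Set
ForestAdj 𝓗 Cut C D = TreeEdge 𝓗 C D × Cut C D ≡ false

SameComponent : ∀ {n} → SetSystem n → (Subset n → Subset n → Bool)
              → Subset n → Subset n → Set
SameComponent 𝓗 Cut = EqClosure (ForestAdj 𝓗 Cut)

-- B ∈ 𝓕(T(𝓗), H): B is the (nonempty) leaf set of the component of
-- T(𝓗) - H containing some vertex V.
InForestPartition : ∀ {n} → SetSystem n → (Subset n → Subset n → Bool)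
                  → Subset n → Set
InForestPartition 𝓗 Cut B =
  Nonempty B ×
  (∃ λ V → V ∈ₛ 𝓗 × (∀ x → (x ∈ B) ⇔ SameComponent 𝓗 Cut V ⁅ x ⁆))

Compatible : ∀ {n} → SetSystem n → SetSystem n → Set
Compatible 𝓗 𝓟 =
  ∃ λ (Cut : Subset _ → Subset _ → Bool) →
    EdgeSubset 𝓗 Cut × (∀ B → (B ∈ₛ 𝓟) ⇔ InForestPartition 𝓗 Cut B)

RCompatible : ∀ {n} → SetSystem n → SetSystem n → Set
RCompatible 𝓗 𝓟 = ∃ λ 𝓗* → IsRefinement 𝓗 𝓗* × Compatible 𝓗* 𝓟

{-# OPTIONS --safe #-}

-- (⇒) In a compatible tree each block of 𝓟 is the leaf set of a component of T − H. If a cluster Y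
-- overlaps a block A, the path in A's component from a leaf inside Y to a leaf outside Y has to
-- pass through the vertex Y, so Y lies in A's component; two blocks overlapped by Y therefore
-- share a component and coincide.
--
-- (⇐) Enlarge each block A to A ⁺, the union of A with all clusters overlapping A. Because no
-- cluster overlaps two blocks, the sets A ⁺ overlap neither each other nor the clusters, so adding
-- them gives a refinement. In its tree, cut every edge except those whose two ends both meet the
-- same block A and lie inside A ⁺: the component of A ⁺ then consists of exactly such vertices,
-- and its leaves are the elements of A.

module Submission where

open import Defs
open import Data.Nat using (ℕ; _≥_)
open import Data.Bool using (Bool; true; false)
import Data.Bool as Bool
open import Data.Fin using (Fin)
open import Data.Fin.Properties using (any?)
open import Data.Fin.Subset using (Subset; _∈_; _∉_; _⊆_; _⊂_; _⊃_; ⁅_⁆; Nonempty)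
  renaming (⊥ to ∅)
open import Data.Fin.Subset.Properties
  using (_∈?_; _⊆?_; _⊂?_; ⊆-refl; ⊆-antisym; ⊆-trans; nonempty?; Empty-unique; ∉⊥; x∈⁅x⁆; x∈⁅y⁆⇒x≡y; anySubset?)
open import Data.Fin.Subset.Induction using (Acc; acc; ⊂-wellFounded; ⊃-wellFounded)
open import Data.Vec using (tabulate; lookup)
open import Data.Vec.Properties using (≡-dec; []=⇒lookup; lookup⇒[]=; lookup∘tabulate)
open import Data.Product using (∃; _×_; _,_; proj₁)
open import Data.Sum using (_⊎_; inj₁; inj₂; swap)
open import Data.Empty using (⊥; ⊥-elim)
open import Relation.Nullary using (¬_; Dec; yes; no; does)
open import Relation.Nullary.Decidable using (_×-dec_; _⊎-dec_; ¬?; map′; decidable-stable; dec-true; dec-false)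
open import Relation.Unary using (Pred; Decidable)
open import Relation.Binary.PropositionalEquality using (_≡_; _≢_; refl; sym; trans; subst)
open import Relation.Binary.Construct.Closure.ReflexiveTransitive using (ε; _◅_; _◅◅_)
open import Relation.Binary.Construct.Closure.Symmetric using (SymClosure; fwd; bwd)
import Relation.Binary.Construct.Closure.Equivalence as EqClosure
open import Function.Base using (_∘_)
open import Level using (0ℓ)
open import Function.Bundles using (_⇔_; mk⇔; Equivalence)

private
  variable
    n : ℕ
    x y : Fin n
    A B C D Y : Subset n

NoDoubleOverlap : SetSystem n → SetSystem n → Set
NoDoubleOverlap {n} 𝓗 𝓟 = ∀ (Y A B : Subset n) → Y ∈ₛ 𝓗 → A ∈ₛ 𝓟 → B ∈ₛ 𝓟 → A ≢ B →
  Overlap Y A → Overlap Y B → ⊥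

false≢true : false ≢ true
false≢true ()

does≡true⇔ : ∀ {P : Set} (P? : Dec P) → does P? ≡ true ⇔ P
does≡true⇔ (yes p) = mk⇔ (λ _ → p) (λ _ → refl)
does≡true⇔ (no ¬p) = mk⇔ (λ ()) (λ p → ⊥-elim (¬p p))

infix 4 _≟ₛ_ _∈ₛ?_

_≟ₛ_ : (p q : Subset n) → Dec (p ≡ q)
_≟ₛ_ = ≡-dec Bool._≟_

_∈ₛ?_ : (A : Subset n) (𝓢 : SetSystem n) → Dec (A ∈ₛ 𝓢)
A ∈ₛ? 𝓢 = 𝓢 A Bool.≟ true

overlap? : (S T : Subset n) → Dec (Overlap S T)
overlap? S T = any? (λ x → x ∈? S ×-dec x ∈? T)
         ×-dec any? (λ x → x ∈? S ×-dec ¬? (x ∈? T))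
         ×-dec any? (λ x → x ∈? T ×-dec ¬? (x ∈? S))

treeEdge? : (𝓢 : SetSystem n) (C D : Subset n) → Dec (TreeEdge 𝓢 C D)
treeEdge? 𝓢 C D = C ∈ₛ? 𝓢 ×-dec D ∈ₛ? 𝓢 ×-dec C ⊂? D ×-dec
  map′
    (λ ¬between E E∈ C⊂E E⊂D → ¬between (E , E∈ , C⊂E , E⊂D))
    (λ noneBetween (E , E∈ , C⊂E , E⊂D) → noneBetween E E∈ C⊂E E⊂D)
    (¬? (anySubset? (λ E → E ∈ₛ? 𝓢 ×-dec C ⊂? E ×-dec E ⊂? D)))

subsetOf : ∀ {P : Pred (Fin n) 0ℓ} → Decidable P → Subset n
subsetOf P? = tabulate (does ∘ P?)

∈subsetOf⇔ : ∀ {P : Pred (Fin n) 0ℓ} (P? : Decidable P) → x ∈ subsetOf P? ⇔ P x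
∈subsetOf⇔ {x = x} P? = mk⇔
  (λ x∈ → Equivalence.to (does≡true⇔ (P? x)) (trans (sym lookup≡) ([]=⇒lookup x∈)))
  (λ Px → lookup⇒[]= x _ (trans lookup≡ (dec-true (P? x) Px)))
  where
  lookup≡ : lookup (subsetOf P?) x ≡ does (P? x)
  lookup≡ = lookup∘tabulate (does ∘ P?) x

systemOf : ∀ {P : Pred (Subset n) 0ℓ} → Decidable P → SetSystem n
systemOf P? = does ∘ P?

∈systemOf⇔ : ∀ {P : Pred (Subset n) 0ℓ} (P? : Decidable P) → A ∈ₛ systemOf P? ⇔ P A
∈systemOf⇔ {A = A} P? = does≡true⇔ (P? A)

⊆⊎⊈ : (p q : Subset n) → p ⊆ q ⊎ ∃ λ x → x ∈ p × x ∉ q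
⊆⊎⊈ p q with any? (λ x → x ∈? p ×-dec ¬? (x ∈? q))
... | yes witness = inj₂ witness
... | no ¬witness = inj₁ λ {x} x∈p →
  decidable-stable (x ∈? q) (λ x∉q → ¬witness (x , x∈p , x∉q))

∈⇒⁅⁆⊆ : x ∈ A → ⁅ x ⁆ ⊆ A
∈⇒⁅⁆⊆ {x = x} {A = A} x∈A y∈⁅x⁆ = subst (_∈ A) (sym (x∈⁅y⁆⇒x≡y x y∈⁅x⁆)) x∈A

Nested : Subset n → Subset n → Set
Nested S T = S ⊆ T ⊎ T ⊆ S

¬Overlap⇒nested : ¬ Overlap A B → x ∈ A → x ∈ B → Nested A B
¬Overlap⇒nested {A = A} {B} {x} ¬ov x∈A x∈B with ⊆⊎⊈ A B | ⊆⊎⊈ B A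
... | inj₁ A⊆B | _ = inj₁ A⊆B
... | inj₂ _ | inj₁ B⊆A = inj₂ B⊆A
... | inj₂ a | inj₂ b = ⊥-elim (¬ov ((x , x∈A , x∈B) , a , b))

nested⇒¬Overlap : Nested A B → ¬ Overlap A B
nested⇒¬Overlap (inj₁ A⊆B) (_ , (a , a∈A , a∉B) , _) = a∉B (A⊆B a∈A)
nested⇒¬Overlap (inj₂ B⊆A) (_ , _ , (b , b∈B , b∉A)) = b∉A (B⊆A b∈B)

cover-within : ∀ {𝓢 : SetSystem n} → Acc _⊂_ D → C ∈ₛ 𝓢 → D ∈ₛ 𝓢 → C ⊂ D →
               ∃ λ E → TreeEdge 𝓢 C E × E ⊆ D
cover-within {D = D} {C} {𝓢} (acc rec) C∈ D∈ C⊂D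
  with anySubset? (λ E → E ∈ₛ? 𝓢 ×-dec C ⊂? E ×-dec E ⊂? D)
... | yes (E , E∈ , C⊂E , E⊂D) with cover-within (rec E⊂D) C∈ E∈ C⊂E
...   | F , C-F , F⊆E = F , C-F , ⊆-trans F⊆E (proj₁ E⊂D)
cover-within {D = D} {C} {𝓢} (acc rec) C∈ D∈ C⊂D | no ¬between =
  D , (C∈ , D∈ , C⊂D , λ E E∈ C⊂E E⊂D → ¬between (E , E∈ , C⊂E , E⊂D)) , ⊆-refl

module Forest {𝓢 : SetSystem n} (hier : IsHierarchy 𝓢) (Cut : Subset n → Subset n → Bool) where
  open IsHierarchy hier

  infix 4 _~_
  _~_ : Subset n → Subset n → Set
  _~_ = SameComponent 𝓢 Cut

  ~-sym : C ~ D → D ~ C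
  ~-sym = EqClosure.symmetric (ForestAdj 𝓢 Cut)

  cluster-nonempty : A ∈ₛ 𝓢 → Nonempty A
  cluster-nonempty {A = A} A∈ =
    decidable-stable (nonempty? A) (λ empty → empty∉ (subst (_∈ₛ 𝓢) (Empty-unique empty) A∈))

  edge-leaving : TreeEdge 𝓢 C D → Y ∈ₛ 𝓢 → C ⊆ Y → ¬ D ⊆ Y → C ≡ Y
  edge-leaving {C = C} {D} {Y} (C∈ , D∈ , C⊂D , ¬between) Y∈ C⊆Y D⊈Y
    with cluster-nonempty C∈
  ... | c , c∈C with ¬Overlap⇒nested (noOverlap Y D Y∈ D∈) (C⊆Y c∈C) (proj₁ C⊂D c∈C)
  ...   | inj₂ D⊆Y = ⊥-elim (D⊈Y D⊆Y)
  ...   | inj₁ Y⊆D with ⊆⊎⊈ Y C | ⊆⊎⊈ D Y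
  ...     | inj₁ Y⊆C | _ = ⊆-antisym C⊆Y Y⊆C
  ...     | inj₂ _ | inj₁ D⊆Y = ⊥-elim (D⊈Y D⊆Y)
  ...     | inj₂ Y∖C | inj₂ D∖Y = ⊥-elim (¬between Y Y∈ (C⊆Y , Y∖C) (Y⊆D , D∖Y))

  path-leaving : C ~ D → Y ∈ₛ 𝓢 → C ⊆ Y → x ∈ D → x ∉ Y → C ~ Y
  path-leaving ε Y∈ C⊆Y x∈D x∉Y = ⊥-elim (x∉Y (C⊆Y x∈D))
  path-leaving {C = C} {Y = Y} (_◅_ {j = C′} step rest) Y∈ C⊆Y x∈D x∉Y with ⊆⊎⊈ C′ Y
  ... | inj₁ C′⊆Y = step ◅ path-leaving rest Y∈ C′⊆Y x∈D x∉Y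
  ... | inj₂ (c , c∈C′ , c∉Y) with step
  ...   | fwd (C-C′ , _) = subst (C ~_) (edge-leaving C-C′ Y∈ C⊆Y λ C′⊆Y → c∉Y (C′⊆Y c∈C′)) ε
  ...   | bwd ((_ , _ , (C′⊆C , _) , _) , _) = ⊥-elim (c∉Y (C⊆Y (C′⊆C c∈C′)))

  LeafSetOf : Subset n → Subset n → Set
  LeafSetOf V A = ∀ x → x ∈ A ⇔ V ~ ⁅ x ⁆

  leafSet-unique : LeafSetOf C A → LeafSetOf D B → C ~ D → A ≡ B
  leafSet-unique leafA leafB C~D = ⊆-antisym
    (λ {x} x∈A → Equivalence.from (leafB x) (~-sym C~D ◅◅ Equivalence.to (leafA x) x∈A))
    (λ {x} x∈B → Equivalence.from (leafA x) (C~D ◅◅ Equivalence.to (leafB x) x∈B))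

  -- A path inside the component of A from a leaf in Y to a leaf outside Y must pass through Y.
  component-reaches-overlapping : LeafSetOf C A → Y ∈ₛ 𝓢 → Overlap Y A → C ~ Y
  component-reaches-overlapping {C = C} leafA Y∈ ((y , y∈Y , y∈A) , _ , (z , z∈A , z∉Y)) =
    C~y ◅◅ path-leaving (~-sym C~y ◅◅ C~z) Y∈ (∈⇒⁅⁆⊆ y∈Y) (x∈⁅x⁆ z) z∉Y
    where
    C~y : C ~ ⁅ y ⁆
    C~y = Equivalence.to (leafA y) y∈A
    C~z : C ~ ⁅ z ⁆
    C~z = Equivalence.to (leafA z) z∈A

compatible⇒noDoubleOverlap : ∀ {𝓢 𝓟 : SetSystem n} → IsHierarchy 𝓢 → Compatible 𝓢 𝓟 →
                             NoDoubleOverlap 𝓢 𝓟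
compatible⇒noDoubleOverlap hier (Cut , _ , blocks) Y A B Y∈ A∈ B∈ A≢B ovA ovB
  with Equivalence.to (blocks A) A∈ | Equivalence.to (blocks B) B∈
... | _ , _ , _ , leafA | _ , _ , _ , leafB = A≢B (leafSet-unique leafA leafB
      (component-reaches-overlapping leafA Y∈ ovA ◅◅ ~-sym (component-reaches-overlapping leafB Y∈ ovB)))
  where open Forest hier Cut

rCompatible⇒noDoubleOverlap : ∀ {𝓗 𝓟 : SetSystem n} → RCompatible 𝓗 𝓟 → NoDoubleOverlap 𝓗 𝓟
rCompatible⇒noDoubleOverlap (𝓗* , (hier* , 𝓗⊆𝓗*) , compatible*) Y A B Y∈ =
  compatible⇒noDoubleOverlap hier* compatible* Y A B (𝓗⊆𝓗* Y Y∈)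

module Closure {𝓗 : SetSystem n} (hier : IsHierarchy 𝓗) where
  open IsHierarchy hier

  OverlapsWith : Subset n → Subset n → Set
  OverlapsWith A Y = Y ∈ₛ 𝓗 × Overlap Y A

  InClosure : Subset n → Fin n → Set
  InClosure A x = x ∈ A ⊎ ∃ λ Y → OverlapsWith A Y × x ∈ Y

  inClosure? : ∀ A → Decidable (InClosure A)
  inClosure? A x = x ∈? A ⊎-dec anySubset? (λ Y → (Y ∈ₛ? 𝓗 ×-dec overlap? Y A) ×-dec x ∈? Y)

  _⁺ : Subset n → Subset n
  A ⁺ = subsetOf (inClosure? A)

  ∈⁺⇔ : x ∈ A ⁺ ⇔ InClosure A x
  ∈⁺⇔ {A = A} = ∈subsetOf⇔ (inClosure? A)

  ⊆⁺ : A ⊆ A ⁺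
  ⊆⁺ x∈A = Equivalence.from ∈⁺⇔ (inj₁ x∈A)

  overlapping⊆⁺ : Y ∈ₛ 𝓗 → Overlap Y A → Y ⊆ A ⁺
  overlapping⊆⁺ {Y = Y} Y∈ ov x∈Y = Equivalence.from ∈⁺⇔ (inj₂ (Y , (Y∈ , ov) , x∈Y))

  ⁺⊆cluster : Y ∈ₛ 𝓗 → A ⊆ Y → A ⁺ ⊆ Y
  ⁺⊆cluster {Y = Y} Y∈ A⊆Y x∈A⁺ with Equivalence.to ∈⁺⇔ x∈A⁺
  ... | inj₁ x∈A = A⊆Y x∈A
  ... | inj₂ (Z , (Z∈ , (z , z∈Z , z∈A) , _ , (a , a∈A , a∉Z)) , x∈Z)
    with ¬Overlap⇒nested (noOverlap Z Y Z∈ Y∈) z∈Z (A⊆Y z∈A)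
  ...   | inj₁ Z⊆Y = Z⊆Y x∈Z
  ...   | inj₂ Y⊆Z = ⊥-elim (a∉Z (Y⊆Z (A⊆Y a∈A)))

  meeting⊆⁺ : Y ∈ₛ 𝓗 → ∃ (λ x → x ∈ Y × x ∈ A) → ∃ (λ a → a ∈ A × a ∉ Y) → Y ⊆ A ⁺
  meeting⊆⁺ {A = A} Y∈ Y∩A A∖Y {y} y∈Y with y ∈? A
  ... | yes y∈A = ⊆⁺ y∈A
  ... | no y∉A = overlapping⊆⁺ Y∈ (Y∩A , (y , y∈Y , y∉A) , A∖Y) y∈Y

  cluster⊆⁺ : Y ∈ₛ 𝓗 → x ∈ Y → x ∈ A ⁺ → ∃ (λ a → a ∈ A × a ∉ Y) → Y ⊆ A ⁺
  cluster⊆⁺ {Y = Y} Y∈ x∈Y x∈A⁺ A∖Y with Equivalence.to ∈⁺⇔ x∈A⁺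
  ... | inj₁ x∈A = meeting⊆⁺ Y∈ (_ , x∈Y , x∈A) A∖Y
  ... | inj₂ (Z , (Z∈ , ovZ@((z , z∈Z , z∈A) , _)) , x∈Z)
    with ¬Overlap⇒nested (noOverlap Y Z Y∈ Z∈) x∈Y x∈Z
  ...   | inj₁ Y⊆Z = ⊆-trans Y⊆Z (overlapping⊆⁺ Z∈ ovZ)
  ...   | inj₂ Z⊆Y = meeting⊆⁺ Y∈ (z , Z⊆Y z∈Z , z∈A) A∖Y

  cluster-nested-⁺ : Y ∈ₛ 𝓗 → x ∈ Y → x ∈ A ⁺ → Nested Y (A ⁺)
  cluster-nested-⁺ {Y = Y} {A = A} Y∈ x∈Y x∈A⁺ with ⊆⊎⊈ A Y
  ... | inj₁ A⊆Y = inj₂ (⁺⊆cluster Y∈ A⊆Y)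
  ... | inj₂ A∖Y = inj₁ (cluster⊆⁺ Y∈ x∈Y x∈A⁺ A∖Y)

module Refinement {𝓗 𝓟 : SetSystem n} (hier : IsHierarchy 𝓗) (part : IsPartition 𝓟)
                  (noDoubleOverlap : NoDoubleOverlap 𝓗 𝓟) where
  open IsHierarchy hier
  open IsPartition part
  open Closure hier

  overlapping-contains-block : Y ∈ₛ 𝓗 → Overlap Y A → A ∈ₛ 𝓟 → B ∈ₛ 𝓟 → A ≢ B →
                               x ∈ Y → x ∈ B → B ⊆ Y
  overlapping-contains-block {Y = Y} {A} {B} {x} Y∈ ovA A∈ B∈ A≢B x∈Y x∈B with ⊆⊎⊈ B Y
  ... | inj₁ B⊆Y = B⊆Y
  ... | inj₂ B∖Y with ovA
  ...   | (a , a∈Y , a∈A) , _ = ⊥-elim (noDoubleOverlap Y A B Y∈ A∈ B∈ A≢B ovA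
          ((x , x∈Y , x∈B) , (a , a∈Y , disjoint A B A∈ B∈ A≢B a a∈A) , B∖Y))

  meets⁺⇒inside-overlapping : A ∈ₛ 𝓟 → B ∈ₛ 𝓟 → A ≢ B → x ∈ B → x ∈ A ⁺ →
                              ∃ λ Z → OverlapsWith A Z × B ⊆ Z
  meets⁺⇒inside-overlapping {A = A} {B} {x} A∈ B∈ A≢B x∈B x∈A⁺ with Equivalence.to ∈⁺⇔ x∈A⁺
  ... | inj₁ x∈A = ⊥-elim (disjoint A B A∈ B∈ A≢B x x∈A x∈B)
  ... | inj₂ (Z , (Z∈ , ovZ) , x∈Z) =
    Z , (Z∈ , ovZ) , overlapping-contains-block Z∈ ovZ A∈ B∈ A≢B x∈Z x∈B

  meets⁺⇒⁺⊆⁺ : A ∈ₛ 𝓟 → B ∈ₛ 𝓟 → A ≢ B → x ∈ B → x ∈ A ⁺ → B ⁺ ⊆ A ⁺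
  meets⁺⇒⁺⊆⁺ A∈ B∈ A≢B x∈B x∈A⁺ with meets⁺⇒inside-overlapping A∈ B∈ A≢B x∈B x∈A⁺
  ... | Z , (Z∈ , ovZ) , B⊆Z = ⊆-trans (⁺⊆cluster Z∈ B⊆Z) (overlapping⊆⁺ Z∈ ovZ)

  -- If B meets A ⁺ via Z and A meets B ⁺ via W, then B ⊆ Z ⊆ A ⁺ ⊆ W, but W overlaps B.
  ¬mutually-meet⁺ : A ∈ₛ 𝓟 → B ∈ₛ 𝓟 → A ≢ B → x ∈ A → x ∈ B ⁺ → y ∈ B → y ∈ A ⁺ → ⊥
  ¬mutually-meet⁺ A∈ B∈ A≢B x∈A x∈B⁺ y∈B y∈A⁺
    with meets⁺⇒inside-overlapping A∈ B∈ A≢B y∈B y∈A⁺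
       | meets⁺⇒inside-overlapping B∈ A∈ (A≢B ∘ sym) x∈A x∈B⁺
  ... | Z , (Z∈ , ovZ) , B⊆Z | W , (W∈ , (_ , _ , (b , b∈B , b∉W))) , A⊆W =
    b∉W (⁺⊆cluster W∈ A⊆W (overlapping⊆⁺ Z∈ ovZ (B⊆Z b∈B)))

  ⁺-meet⇒meets⁺ : x ∈ A ⁺ → x ∈ B ⁺ →
                  (∃ λ a → a ∈ A × a ∈ B ⁺) ⊎ (∃ λ b → b ∈ B × b ∈ A ⁺)
  ⁺-meet⇒meets⁺ x∈A⁺ x∈B⁺ with Equivalence.to ∈⁺⇔ x∈A⁺ | Equivalence.to ∈⁺⇔ x∈B⁺
  ... | inj₁ x∈A | _ = inj₁ (_ , x∈A , x∈B⁺)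
  ... | inj₂ _ | inj₁ x∈B = inj₂ (_ , x∈B , x∈A⁺)
  ... | inj₂ (Z , (Z∈ , ovZ@((z , z∈Z , z∈A) , _)) , x∈Z)
      | inj₂ (W , (W∈ , ovW@((w , w∈W , w∈B) , _)) , x∈W)
    with ¬Overlap⇒nested (noOverlap Z W Z∈ W∈) x∈Z x∈W
  ...   | inj₁ Z⊆W = inj₁ (z , z∈A , overlapping⊆⁺ W∈ ovW (Z⊆W z∈Z))
  ...   | inj₂ W⊆Z = inj₂ (w , w∈B , overlapping⊆⁺ Z∈ ovZ (W⊆Z w∈W))

  ⁺-nested : A ∈ₛ 𝓟 → B ∈ₛ 𝓟 → x ∈ A ⁺ → x ∈ B ⁺ → Nested (A ⁺) (B ⁺)
  ⁺-nested {A = A} {B} A∈ B∈ x∈A⁺ x∈B⁺ with A ≟ₛ B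
  ... | yes refl = inj₁ ⊆-refl
  ... | no A≢B with ⁺-meet⇒meets⁺ x∈A⁺ x∈B⁺
  ...   | inj₁ (a , a∈A , a∈B⁺) = inj₁ (meets⁺⇒⁺⊆⁺ B∈ A∈ (A≢B ∘ sym) a∈A a∈B⁺)
  ...   | inj₂ (b , b∈B , b∈A⁺) = inj₂ (meets⁺⇒⁺⊆⁺ A∈ B∈ A≢B b∈B b∈A⁺)

  IsBlockClosure : Subset n → Set
  IsBlockClosure S = ∃ λ A → A ∈ₛ 𝓟 × S ≡ A ⁺

  InRefinement : Subset n → Set
  InRefinement S = S ∈ₛ 𝓗 ⊎ IsBlockClosure S

  inRefinement? : Decidable InRefinement
  inRefinement? S = S ∈ₛ? 𝓗 ⊎-dec anySubset? (λ A → A ∈ₛ? 𝓟 ×-dec S ≟ₛ A ⁺)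

  𝓗⁺ : SetSystem n
  𝓗⁺ = systemOf inRefinement?

  ∈𝓗⁺⇔ : A ∈ₛ 𝓗⁺ ⇔ InRefinement A
  ∈𝓗⁺⇔ = ∈systemOf⇔ inRefinement?

  𝓗⊆𝓗⁺ : A ∈ₛ 𝓗 → A ∈ₛ 𝓗⁺
  𝓗⊆𝓗⁺ A∈ = Equivalence.from ∈𝓗⁺⇔ (inj₁ A∈)

  ⁺∈𝓗⁺ : A ∈ₛ 𝓟 → A ⁺ ∈ₛ 𝓗⁺
  ⁺∈𝓗⁺ A∈ = Equivalence.from ∈𝓗⁺⇔ (inj₂ (_ , A∈ , refl))

  𝓗⁺-nested : C ∈ₛ 𝓗⁺ → D ∈ₛ 𝓗⁺ → x ∈ C → x ∈ D → Nested C D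
  𝓗⁺-nested {C = C} {D} C∈ D∈ x∈C x∈D with Equivalence.to ∈𝓗⁺⇔ C∈ | Equivalence.to ∈𝓗⁺⇔ D∈
  ... | inj₁ C∈𝓗 | inj₁ D∈𝓗 = ¬Overlap⇒nested (noOverlap C D C∈𝓗 D∈𝓗) x∈C x∈D
  ... | inj₁ C∈𝓗 | inj₂ (_ , _ , refl) = cluster-nested-⁺ C∈𝓗 x∈C x∈D
  ... | inj₂ (_ , _ , refl) | inj₁ D∈𝓗 = swap (cluster-nested-⁺ D∈𝓗 x∈D x∈C)
  ... | inj₂ (_ , A∈ , refl) | inj₂ (_ , B∈ , refl) = ⁺-nested A∈ B∈ x∈C x∈D

  𝓗⁺-hierarchy : IsHierarchy 𝓗⁺
  𝓗⁺-hierarchy = record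
    { empty∉     = ∅∉𝓗⁺
    ; full∈      = 𝓗⊆𝓗⁺ full∈
    ; singleton∈ = λ x → 𝓗⊆𝓗⁺ (singleton∈ x)
    ; noOverlap  = λ C D C∈ D∈ ov@((x , x∈C , x∈D) , _) →
                     nested⇒¬Overlap (𝓗⁺-nested C∈ D∈ x∈C x∈D) ov
    }
    where
    ∅∉𝓗⁺ : ¬ (∅ ∈ₛ 𝓗⁺)
    ∅∉𝓗⁺ ∅∈ with Equivalence.to ∈𝓗⁺⇔ ∅∈
    ... | inj₁ ∅∈𝓗 = empty∉ ∅∈𝓗
    ... | inj₂ (A , A∈ , ∅≡A⁺) with nonempty A A∈
    ...   | a , a∈A = ∉⊥ (subst (a ∈_) (sym ∅≡A⁺) (⊆⁺ a∈A))

  Spans : Subset n → Subset n → Set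
  Spans A C = (∃ λ x → x ∈ C × x ∈ A) × C ⊆ A ⁺

  spans? : (A C : Subset n) → Dec (Spans A C)
  spans? A C = any? (λ x → x ∈? C ×-dec x ∈? A) ×-dec C ⊆? A ⁺

  spans-unique : A ∈ₛ 𝓟 → B ∈ₛ 𝓟 → Spans A C → Spans B C → A ≡ B
  spans-unique {A = A} {B} A∈ B∈ ((a , a∈C , a∈A) , C⊆A⁺) ((b , b∈C , b∈B) , C⊆B⁺) with A ≟ₛ B
  ... | yes A≡B = A≡B
  ... | no A≢B = ⊥-elim (¬mutually-meet⁺ A∈ B∈ A≢B a∈A (C⊆B⁺ a∈C) b∈B (C⊆A⁺ b∈C))

  spans-between : C ⊆ D → D ⊆ B → Spans A C → Spans A B → Spans A D
  spans-between C⊆D D⊆B ((x , x∈C , x∈A) , _) (_ , B⊆A⁺) = (x , C⊆D x∈C , x∈A) , ⊆-trans D⊆B B⊆A⁺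

  JointlySpanned : Subset n → Subset n → Set
  JointlySpanned C D = ∃ λ A → A ∈ₛ 𝓟 × Spans A C × Spans A D

  jointlySpanned? : (C D : Subset n) → Dec (JointlySpanned C D)
  jointlySpanned? C D = anySubset? (λ A → A ∈ₛ? 𝓟 ×-dec spans? A C ×-dec spans? A D)

  cut? : (C D : Subset n) → Dec (TreeEdge 𝓗⁺ C D × ¬ JointlySpanned C D)
  cut? C D = treeEdge? 𝓗⁺ C D ×-dec ¬? (jointlySpanned? C D)

  cut : Subset n → Subset n → Bool
  cut C D = does (cut? C D)

  cut⊆edges : EdgeSubset 𝓗⁺ cut
  cut⊆edges C D removed = proj₁ (Equivalence.to (does≡true⇔ (cut? C D)) removed)

  cut-kept : JointlySpanned C D → cut C D ≡ false
  cut-kept {C = C} {D} joint = dec-false (cut? C D) (λ (_ , ¬joint) → ¬joint joint)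

  adj⇒jointlySpanned : ForestAdj 𝓗⁺ cut C D → JointlySpanned C D
  adj⇒jointlySpanned {C = C} {D} (C-D , kept) = decidable-stable (jointlySpanned? C D)
    λ ¬joint → false≢true (trans (sym kept) (dec-true (cut? C D) (C-D , ¬joint)))

  open Forest 𝓗⁺-hierarchy cut

  step⇒jointlySpanned : SymClosure (ForestAdj 𝓗⁺ cut) C D → JointlySpanned C D
  step⇒jointlySpanned (fwd adj) = adj⇒jointlySpanned adj
  step⇒jointlySpanned (bwd adj) with adj⇒jointlySpanned adj
  ... | B , B∈ , spansD , spansC = B , B∈ , spansC , spansD

  spans-transport : C ~ D → A ∈ₛ 𝓟 → Spans A C → Spans A D
  spans-transport ε A∈ spansC = spansC
  spans-transport (step ◅ rest) A∈ spansC with step⇒jointlySpanned step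
  ... | B , B∈ , spansB₁ , spansB₂ =
    spans-transport rest A∈ (subst (λ X → Spans X _) (spans-unique B∈ A∈ spansB₁ spansC) spansB₂)

  -- Climb from C to D through the covers of the tree, all of which lie between C and D and so span A.
  spans-connected : Acc _⊃_ C → A ∈ₛ 𝓟 → C ∈ₛ 𝓗⁺ → D ∈ₛ 𝓗⁺ → C ⊆ D →
                    Spans A C → Spans A D → C ~ D
  spans-connected {C = C} {A = A} {D = D} (acc rec) A∈ C∈ D∈ C⊆D spansC spansD with ⊆⊎⊈ D C
  ... | inj₁ D⊆C = subst (C ~_) (⊆-antisym C⊆D D⊆C) ε
  ... | inj₂ D∖C with cover-within (⊂-wellFounded D) C∈ D∈ (C⊆D , D∖C)
  ...   | E , C-E@(_ , E∈ , C⊂E , _) , E⊆D =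
    fwd (C-E , cut-kept (_ , A∈ , spansC , spansE))
      ◅ spans-connected (rec C⊂E) A∈ E∈ D∈ E⊆D spansE spansD
    where
    spansE : Spans A E
    spansE = spans-between (proj₁ C⊂E) E⊆D spansC spansD

  ⁺-leafSet : A ∈ₛ 𝓟 → LeafSetOf (A ⁺) A
  ⁺-leafSet {A = A} A∈ x = mk⇔ block⇒~ ~⇒block
    where
    spans⁺ : Spans A (A ⁺)
    spans⁺ with nonempty A A∈
    ... | a , a∈A = (a , ⊆⁺ a∈A , a∈A) , ⊆-refl
    block⇒~ : x ∈ A → A ⁺ ~ ⁅ x ⁆
    block⇒~ x∈A = ~-sym (spans-connected (⊃-wellFounded ⁅ x ⁆) A∈ (𝓗⊆𝓗⁺ (singleton∈ x)) (⁺∈𝓗⁺ A∈)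
      x⊆A⁺ ((x , x∈⁅x⁆ x , x∈A) , x⊆A⁺) spans⁺)
      where
      x⊆A⁺ : ⁅ x ⁆ ⊆ A ⁺
      x⊆A⁺ = ∈⇒⁅⁆⊆ (⊆⁺ x∈A)
    ~⇒block : A ⁺ ~ ⁅ x ⁆ → x ∈ A
    ~⇒block A⁺~x with spans-transport A⁺~x A∈ spans⁺
    ... | (y , y∈⁅x⁆ , y∈A) , _ = subst (_∈ A) (x∈⁅y⁆⇒x≡y x y∈⁅x⁆) y∈A

  compatible : Compatible 𝓗⁺ 𝓟
  compatible = cut , cut⊆edges , λ B → mk⇔ (block⇒forestBlock B) (forestBlock⇒block B)
    where
    block⇒forestBlock : ∀ B → B ∈ₛ 𝓟 → InForestPartition 𝓗⁺ cut B
    block⇒forestBlock B B∈ = nonempty B B∈ , B ⁺ , ⁺∈𝓗⁺ B∈ , ⁺-leafSet B∈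
    forestBlock⇒block : ∀ B → InForestPartition 𝓗⁺ cut B → B ∈ₛ 𝓟
    forestBlock⇒block B ((x , x∈B) , V , _ , leafB) with cover x
    ... | A , A∈ , x∈A = subst (_∈ₛ 𝓟) (leafSet-unique (⁺-leafSet A∈) leafB A⁺~V) A∈
      where
      A⁺~V : A ⁺ ~ V
      A⁺~V = Equivalence.to (⁺-leafSet A∈ x) x∈A ◅◅ ~-sym (Equivalence.to (leafB x) x∈B)

  rCompatible : RCompatible 𝓗 𝓟
  rCompatible = 𝓗⁺ , (𝓗⁺-hierarchy , λ _ → 𝓗⊆𝓗⁺) , compatible

theorem5p7 : (n : ℕ) → n ≥ 2 → (𝓗 𝓟 : SetSystem n) →
    IsHierarchy 𝓗 → IsPartition 𝓟 →
    RCompatible 𝓗 𝓟 ⇔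
      (∀ (Y A B : Subset n) → Y ∈ₛ 𝓗 → A ∈ₛ 𝓟 → B ∈ₛ 𝓟 → A ≢ B →
        Overlap Y A → Overlap Y B → ⊥)
theorem5p7 n _ 𝓗 𝓟 hier part = mk⇔ rCompatible⇒noDoubleOverlap (Refinement.rCompatible hier part)
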